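{- For every $n\in\mathbb{Z}^+$, there is a TAS $\mathcal{T}=(T,\sigma,g,\tau)$ with $|T|=4n$ such that for every TAS $\mathcal{T}'=(T,\sigma,g',\tau')$ that is locally equivalent to $\mathcal{T}$, we have $\tau'\ge 2^n$.
   Context: Let $D_{\mathrm{all}}=\{\mathrm{N},\mathrm{S},\mathrm{E},\mathrm{W}\}$. A tile type is a map $t:D_{\mathrm{all}}\to\Lambda$ assigning a glue label to each side; $\Lambda(T)$ is the set of glue labels on tile types of $T$. A TAS is $(T,\sigma,g,\tau)$ with $T$ a finite set of tile types, $\sigma$ a single-tile seed, $g:\Lambda(T)\to\mathbb{N}$ a strength function and $\tau\in\mathbb{Z}^+$ a temperature. The cooperation set of $t\in T$ is $\mathcal{D}_{g,\tau}(t)=\{D\subseteq D_{\mathrm{all}}:\sum_{d\in D}g(t(d))\ge\tau\}$. Two TAS's $(T,\sigma,g_1,\tau_1)$ and $(T,\sigma,g_2,\tau_2)$ are locally equivalent if $\mathcal{D}_{g_1,\tau_1}(t)=\mathcal{D}_{g_2,\tau_2}(t)$ for every $t\in T$. -}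

module Defs where

open import Data.Nat using (ℕ; _+_; _≤_)
open import Data.Bool using (Bool; true; false; if_then_else_)
open import Data.List using (List)
open import Data.List.Membership.Propositional using (_∈_)
open import Data.List.Relation.Unary.Unique.Propositional using (Unique)
open import Relation.Binary.PropositionalEquality using (_≡_)
open import Function.Bundles using (_⇔_)

data Dir : Set where
  N S E W : Dir

-- Glue labels are natural numbers (any finite label set embeds into ℕ).
Label : Set
Label = ℕ

record Tile : Set where
  constructor tile
  field
    north south east west : Label

glue : Tile → Dir → Label
glue t N = Tile.north t
glue t S = Tile.south t
glue t E = Tile.east t
glue t W = Tile.west t

DirSet : Set
DirSet = Dir → Bool

strength : (Label → ℕ) → Tile → DirSet → ℕ
strength g t D = c N + c S + c E + c W
  where
  c : Dir → ℕ
  c d = if D d then g (glue t d) else 0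

Cooperates : (Label → ℕ) → ℕ → Tile → DirSet → Set
Cooperates g τ t D = τ ≤ strength g t D

-- A tile assembly system (T, σ, g, τ): T a finite set of tile types
-- (duplicate-free list), σ a single-tile seed of a type in T,
-- g a strength function, τ a positive temperature.
record TAS : Set where
  field
    T      : List Tile
    T-uniq : Unique T
    σ      : Tile
    σ∈T    : σ ∈ T
    g      : Label → ℕ
    τ      : ℕ
    τ-pos  : 1 ≤ τ

open TAS public

-- Local equivalence: equal cooperation sets for every tile type of 𝒯₁
-- (only meaningful when both share T, which the theorem requires).
LocallyEquivalent : TAS → TAS → Set
LocallyEquivalent 𝒯₁ 𝒯₂ =
  ∀ t → t ∈ T 𝒯₁ → ∀ (D : DirSet) →
    Cooperates (g 𝒯₁) (τ 𝒯₁) t D ⇔ Cooperates (g 𝒯₂) (τ 𝒯₂) t D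

module Submission where

-- Fix n = 1 + m and take τ = 2ⁿ. For each k < n there are two
-- "working" tile types: a step tile A_k with north glue b_{k+1} and south
-- glue e_k, and a test tile B_k with north and south glue b_k and east glue
-- e_k; two padding tiles per k (all glues of strength 0) bring |T| to 4n.
-- Strengths are g(b_k) = 2ᵏ - 1 and g(e_k) = 2ⁿ - (2ᵏ⁺¹ - 1), so that {N,S}
-- cooperates on A_k (total exactly 2ⁿ), {N,S,E} does not on B_k (total 2ⁿ - 1),
-- and {N} does not on the seed A_{n-1} (total 2ⁿ - 1).
--
-- If (g′, τ′) is locally equivalent, the A_k and B_k conditions
-- give g′(b_{k+1}) + g′(e_k) ≥ τ′ > 2 g′(b_k) + g′(e_k), hence
-- g′(b_{k+1}) ≥ 2 g′(b_k) + 1; a general doubling lemma then yields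
-- 2ⁿ ≤ 1 + g′(b_n), while the seed condition gives g′(b_n) < τ′.

open import Defs
open import Data.Nat using (ℕ; _*_; _^_; _≤_)
open import Data.List using (length)
open import Data.Product using (Σ; _×_)
open import Relation.Binary.PropositionalEquality using (_≡_)

open import Data.Nat using (zero; suc; _+_; _∸_; _<_; z≤n; s≤s)
open import Data.Nat.Properties
open import Data.Bool using (true; false)
open import Data.List using (List; []; _∷_; _++_; map; downFrom)
open import Data.List.Properties using (length-map; length-downFrom)
open import Data.List.Relation.Unary.Any using (here; there)
open import Data.List.Membership.Propositional using (_∈_)
open import Data.List.Membership.Propositional.Properties using (∈-++⁺ˡ; ∈-++⁺ʳ)
open import Data.List.Relation.Unary.Unique.Propositional using (Unique)
open import Data.List.Relation.Unary.Unique.Propositional.Properties using (map⁻; downFrom⁺)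
open import Data.Product using (_,_)
open import Data.Sum using (inj₁; inj₂)
open import Function using (_∘_)
open import Function.Bundles using (Equivalence)
open import Relation.Binary.PropositionalEquality using (refl; sym; trans; cong; cong₂; subst; module ≡-Reasoning)

northOnly northSouth allButWest : DirSet
northOnly N = true
northOnly _ = false
northSouth N = true
northSouth S = true
northSouth _ = false
allButWest W = false
allButWest _ = true

strength-N : ∀ g t → strength g t northOnly ≡ g (Tile.north t)
strength-N g t = trans (+-identityʳ _) (trans (+-identityʳ _) (+-identityʳ _))

strength-NS : ∀ g t → strength g t northSouth ≡ g (Tile.north t) + g (Tile.south t)
strength-NS g t = trans (+-identityʳ _) (+-identityʳ _)

strength-NSE : ∀ g t →
  strength g t allButWest ≡ g (Tile.north t) + g (Tile.south t) + g (Tile.east t)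
strength-NSE g t = +-identityʳ _

module _ (𝒯 𝒯′ : TAS) (equiv : LocallyEquivalent 𝒯 𝒯′)
         {t : Tile} (t∈T : t ∈ T 𝒯) (D : DirSet) where

  cooperation-transfers : τ 𝒯 ≤ strength (g 𝒯) t D → τ 𝒯′ ≤ strength (g 𝒯′) t D
  cooperation-transfers = Equivalence.to (equiv t t∈T D)

  failure-transfers : strength (g 𝒯) t D < τ 𝒯 → strength (g 𝒯′) t D < τ 𝒯′
  failure-transfers below =
    ≰⇒> (λ coop′ → <⇒≱ below (Equivalence.from (equiv t t∈T D) coop′))

cancel-summand : ∀ {a b c τ} → τ ≤ b + c → a + c < τ → a < b
cancel-summand {a} {b} {c} above below = +-cancelʳ-< c a b (<-≤-trans below above)

doubling-bound : ∀ (x : ℕ → ℕ) n → (∀ k → k < n → suc (x k + x k) ≤ x (suc k)) →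
                 ∀ k → k ≤ n → 2 ^ k ≤ suc (x k)
doubling-bound x n doubles zero    _   = s≤s z≤n
doubling-bound x n doubles (suc k) k<n = begin
  2 ^ k + (2 ^ k + 0)          ≤⟨ +-mono-≤ ih (+-monoˡ-≤ 0 ih) ⟩
  suc (x k) + (suc (x k) + 0)  ≡⟨ cong (suc (x k) +_) (+-identityʳ _) ⟩
  suc (x k) + suc (x k)        ≡⟨ cong suc (+-suc (x k) (x k)) ⟩
  suc (suc (x k + x k))        ≤⟨ s≤s (doubles k k<n) ⟩
  suc (x (suc k))              ∎
  where
  open ≤-Reasoning
  ih : 2 ^ k ≤ suc (x k)
  ih = doubling-bound x n doubles k (<⇒≤ k<n)

-- ones k = 2ᵏ - 1, defined by the recurrence that the lower bound mirrors.
ones : ℕ → ℕ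
ones zero    = zero
ones (suc k) = suc (ones k + ones k)

ones-pow : ∀ k → 2 ^ k ≡ suc (ones k)
ones-pow zero    = refl
ones-pow (suc k) = begin
  2 ^ k + (2 ^ k + 0)            ≡⟨ cong₂ (λ a b → a + (b + 0)) (ones-pow k) (ones-pow k) ⟩
  suc (ones k) + (suc (ones k) + 0)  ≡⟨ cong (suc (ones k) +_) (+-identityʳ _) ⟩
  suc (ones k) + suc (ones k)    ≡⟨ cong suc (+-suc (ones k) (ones k)) ⟩
  suc (suc (ones k + ones k))    ∎
  where open ≡-Reasoning

ones-< : ∀ k → ones k < 2 ^ k
ones-< k = ≤-reflexive (sym (ones-pow k))

-- 2ᵏ⁺¹ - 1 + (2ⁿ - (2ᵏ⁺¹ - 1)) = 2ⁿ for k < n: the two glues of A_k add up to τ.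
ones-complement : ∀ {k n} → k < n → ones (suc k) + (2 ^ n ∸ ones (suc k)) ≡ 2 ^ n
ones-complement {k} k<n =
  m+[n∸m]≡n (≤-trans (<⇒≤ (ones-< (suc k))) (^-monoʳ-≤ 2 k<n))

-- Label 0 is the null glue; b_k = 2k + 1 and e_k = 2k + 2.
bitGlue fillGlue : ℕ → Label
bitGlue k  = suc (k * 2)
fillGlue k = suc (suc (k * 2))

interleave : (ℕ → ℕ) → (ℕ → ℕ) → Label → ℕ
interleave f e zero                = 0
interleave f e (suc zero)          = f 0
interleave f e (suc (suc zero))    = e 0
interleave f e (suc (suc (suc x))) = interleave (f ∘ suc) (e ∘ suc) (suc x)

interleave-bit : ∀ f e k → interleave f e (bitGlue k) ≡ f k
interleave-bit f e zero    = refl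
interleave-bit f e (suc k) = interleave-bit (f ∘ suc) (e ∘ suc) k

interleave-fill : ∀ f e k → interleave f e (fillGlue k) ≡ e k
interleave-fill f e zero    = refl
interleave-fill f e (suc k) = interleave-fill (f ∘ suc) (e ∘ suc) k

designStrength : ℕ → Label → ℕ
designStrength n = interleave ones (λ k → 2 ^ n ∸ ones (suc k))

designStrength-bit : ∀ n k → designStrength n (bitGlue k) ≡ ones k
designStrength-bit n = interleave-bit ones (λ k → 2 ^ n ∸ ones (suc k))

designStrength-fill : ∀ n k → designStrength n (fillGlue k) ≡ 2 ^ n ∸ ones (suc k)
designStrength-fill n = interleave-fill ones (λ k → 2 ^ n ∸ ones (suc k))

stepTile testTile padTile padTile′ : ℕ → Tile
stepTile k = tile (bitGlue (suc k)) (fillGlue k) 0 (k * 4)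
testTile k = tile (bitGlue k) (bitGlue k) (fillGlue k) (suc (k * 4))
padTile  k = tile 0 0 0 (suc (suc (k * 4)))
padTile′ k = tile 0 0 0 (suc (suc (suc (k * 4))))

block : ℕ → List Tile
block k = padTile′ k ∷ padTile k ∷ testTile k ∷ stepTile k ∷ []

tiles : ℕ → List Tile
tiles zero    = []
tiles (suc m) = block m ++ tiles m

-- The west glues enumerate 4m - 1, …, 0; hence distinctness and the size.
tiles-west : ∀ m → map Tile.west (tiles m) ≡ downFrom (m * 4)
tiles-west zero    = refl
tiles-west (suc m) = cong (map Tile.west (block m) ++_) (tiles-west m)

tiles-unique : ∀ m → Unique (tiles m)
tiles-unique m = map⁻ (subst Unique (sym (tiles-west m)) (downFrom⁺ (m * 4)))

tiles-length : ∀ m → length (tiles m) ≡ 4 * m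
tiles-length m = begin
  length (tiles m)                  ≡⟨ sym (length-map Tile.west (tiles m)) ⟩
  length (map Tile.west (tiles m))  ≡⟨ cong length (tiles-west m) ⟩
  length (downFrom (m * 4))         ≡⟨ length-downFrom (m * 4) ⟩
  m * 4                             ≡⟨ *-comm m 4 ⟩
  4 * m                             ∎
  where open ≡-Reasoning

block-⊆ : ∀ {k m t} → k < m → t ∈ block k → t ∈ tiles m
block-⊆ {k} {suc m} k<1+m t∈block with m<1+n⇒m<n∨m≡n k<1+m
... | inj₁ k<m = ∈-++⁺ʳ (block m) (block-⊆ k<m t∈block)
... | inj₂ refl = ∈-++⁺ˡ t∈block

stepTile∈ : ∀ {m} k → k < m → stepTile k ∈ tiles m
stepTile∈ k k<m = block-⊆ {k} k<m (there (there (there (here refl))))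

testTile∈ : ∀ {m} k → k < m → testTile k ∈ tiles m
testTile∈ k k<m = block-⊆ {k} k<m (there (there (here refl)))

design : ℕ → TAS
design m = record
  { T = tiles (suc m) ; T-uniq = tiles-unique (suc m)
  ; σ = stepTile m    ; σ∈T = stepTile∈ m ≤-refl
  ; g = designStrength (suc m) ; τ = 2 ^ suc m ; τ-pos = m^n>0 2 (suc m) }

stepTile-strength : ∀ n {k} → k < n →
  strength (designStrength n) (stepTile k) northSouth ≡ 2 ^ n
stepTile-strength n {k} k<n = begin
  strength g₀ (stepTile k) northSouth        ≡⟨ strength-NS g₀ (stepTile k) ⟩
  g₀ (bitGlue (suc k)) + g₀ (fillGlue k)     ≡⟨ cong₂ _+_ (designStrength-bit n (suc k)) (designStrength-fill n k) ⟩
  ones (suc k) + (2 ^ n ∸ ones (suc k))      ≡⟨ ones-complement k<n ⟩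
  2 ^ n                                      ∎
  where open ≡-Reasoning; g₀ = designStrength n

testTile-strength : ∀ n {k} → k < n →
  suc (strength (designStrength n) (testTile k) allButWest) ≡ 2 ^ n
testTile-strength n {k} k<n = begin
  suc (strength g₀ (testTile k) allButWest)
    ≡⟨ cong suc (strength-NSE g₀ (testTile k)) ⟩
  suc (g₀ (bitGlue k) + g₀ (bitGlue k) + g₀ (fillGlue k))
    ≡⟨ cong suc (cong₂ _+_ (cong₂ _+_ bit bit) (designStrength-fill n k)) ⟩
  ones (suc k) + (2 ^ n ∸ ones (suc k))
    ≡⟨ ones-complement k<n ⟩
  2 ^ n ∎
  where
  open ≡-Reasoning
  g₀ = designStrength n
  bit = designStrength-bit n k

seed-fails : ∀ m → strength (designStrength (suc m)) (stepTile m) northOnly < 2 ^ suc m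
seed-fails m = subst (_< 2 ^ suc m)
  (sym (trans (strength-N (designStrength (suc m)) (stepTile m)) (designStrength-bit (suc m) (suc m))))
  (ones-< (suc m))

temperature-bound : ∀ m (𝒯′ : TAS) → LocallyEquivalent (design m) 𝒯′ → 2 ^ suc m ≤ τ 𝒯′
temperature-bound m 𝒯′ equiv =
  ≤-trans (doubling-bound x (suc m) doubles (suc m) ≤-refl) seed-bound
  where
  x : ℕ → ℕ
  x k = g 𝒯′ (bitGlue k)

  -- A_k still cooperates and B_k still fails, forcing x(k+1) ≥ 2x(k) + 1.
  doubles : ∀ k → k < suc m → suc (x k + x k) ≤ x (suc k)
  doubles k k<n = cancel-summand step-cooperates test-fails
    where
    step-cooperates : τ 𝒯′ ≤ x (suc k) + g 𝒯′ (fillGlue k)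
    step-cooperates = subst (τ 𝒯′ ≤_) (strength-NS (g 𝒯′) (stepTile k))
      (cooperation-transfers (design m) 𝒯′ equiv (stepTile∈ k k<n) northSouth
        (≤-reflexive (sym (stepTile-strength (suc m) k<n))))
    test-fails : x k + x k + g 𝒯′ (fillGlue k) < τ 𝒯′
    test-fails = subst (_< τ 𝒯′) (strength-NSE (g 𝒯′) (testTile k))
      (failure-transfers (design m) 𝒯′ equiv (testTile∈ k k<n) allButWest
        (≤-reflexive (testTile-strength (suc m) k<n)))

  -- The seed still fails on {N}, so x n < τ′.
  seed-bound : suc (x (suc m)) ≤ τ 𝒯′
  seed-bound = subst (_< τ 𝒯′) (strength-N (g 𝒯′) (stepTile m))
    (failure-transfers (design m) 𝒯′ equiv (stepTile∈ m ≤-refl) northOnly (seed-fails m))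

theorem5p1 : ∀ (n : ℕ) → 1 ≤ n →
    Σ TAS (λ 𝒯 → length (T 𝒯) ≡ 4 * n ×
      (∀ (𝒯′ : TAS) → T 𝒯′ ≡ T 𝒯 → σ 𝒯′ ≡ σ 𝒯 →
        LocallyEquivalent 𝒯 𝒯′ → 2 ^ n ≤ τ 𝒯′))
theorem5p1 zero    ()
theorem5p1 (suc m) _ =
  design m , tiles-length (suc m) , λ 𝒯′ _ _ → temperature-bound m 𝒯′
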